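{- Let $n\ge 3$ and let $\mu_{\mathcal P_n}$ be the Möbius function of the poset $\mathcal P_n$. Then $\mu_{\mathcal P_n}(S,T)=(-1)^{|T|-|S|}$ for all $S\preceq T$ in $\mathcal P_n$.
   Context: $[n]=\{1,\dots,n\}$; $\mathfrak S_n$ is the set of permutations of $[n]$ in one-line notation. The circular peak set of $\sigma\in\mathfrak S_n$ is $CP(\sigma)=\{\sigma(i)\mid 2\le i\le n-1,\ \sigma(i-1)<\sigma(i)>\sigma(i+1)\}$; for $S\subseteq[n]$, $CP_n(S)=\{\sigma\in\mathfrak S_n\mid CP(\sigma)=S\}$, and $\mathcal P_n=\{S\subseteq[n]\mid CP_n(S)\neq\emptyset\}$, a poset with $S\preceq T$ iff $S\subseteq T$. -}

module Defs where

open import Data.Bool using (Bool; true; false; if_then_else_; _∧_)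
open import Data.Nat using (ℕ; zero; suc; _∸_)
open import Data.Fin using (Fin; _<?_)
open import Data.Fin.Properties using () renaming (_≟_ to _≟ᶠ_)
open import Data.Fin.Subset using (Subset; _⊆_; ∣_∣; _∈_)
open import Data.Fin.Subset.Properties using (_⊆?_)
open import Data.Vec.Properties using (≡-dec)
import Data.Bool.Properties as BoolP
open import Relation.Binary.Definitions using (DecidableEquality)
open import Data.Integer using (ℤ; 0ℤ; 1ℤ; -_; _+_; _^_; -1ℤ)
open import Data.List using (List; []; _∷_; _++_; map; concatMap; filter; length; foldr)
open import Data.List.Relation.Unary.Any using (Any; any?)
import Data.List.Relation.Unary.Unique.DecPropositional as UniqueDec
open import Data.Vec using (Vec; []; _∷_; tabulate)
open import Relation.Nullary using (yes; no; ¬?; does)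
open import Relation.Nullary.Decidable using (⌊_⌋; _×-dec_)
open import Relation.Binary.PropositionalEquality using (_≡_)

-- Conventions: [n] is modelled by Fin n, where i : Fin n stands for the
-- number toℕ i + 1.  A subset of [n] is a Data.Fin.Subset (Vec Bool n).

_≟ˢ_ : {n : ℕ} → DecidableEquality (Subset n)
_≟ˢ_ = ≡-dec BoolP._≟_

words : (n m : ℕ) → List (List (Fin n))
words n zero    = [] ∷ []
words n (suc m) = concatMap (λ w → map (_∷ w) (Data.List.allFin n)) (words n m)

-- 𝔖ₙ : permutations of [n] in one-line notation = words of length n
-- over [n] with pairwise distinct letters.
perms : (n : ℕ) → List (List (Fin n))
perms n = filter (λ σ → UniqueDec.unique? (_≟ᶠ_ {n}) σ) (words n n)

peakValues : {n : ℕ} → List (Fin n) → List (Fin n)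
peakValues (a ∷ w@(b ∷ c ∷ _)) =
  if does (a <? b) ∧ does (c <? b) then b ∷ peakValues w else peakValues w
peakValues _ = []

CP : {n : ℕ} → List (Fin n) → Subset n
CP σ = tabulate (λ v → ⌊ any? (λ p → p ≟ᶠ v) (peakValues σ) ⌋)

-- S ∈ 𝒫ₙ  iff  CPₙ(S) ≠ ∅, i.e. some σ ∈ 𝔖ₙ has CP(σ) = S.
InP : (n : ℕ) → Subset n → Set
InP n S = Any (λ σ → CP σ ≡ S) (perms n)

subsets : (n : ℕ) → List (Subset n)
subsets zero    = [] ∷ []
subsets (suc n) = map (true ∷_) (subsets n) ++ map (false ∷_) (subsets n)

elemsP : (n : ℕ) → List (Subset n)
elemsP n = filter (λ S → any? (λ σ → CP σ ≟ˢ S) (perms n)) (subsets n)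

sumℤ : List ℤ → ℤ
sumℤ = foldr _+_ 0ℤ

-- The fuel argument only ensures termination; since strict chains in 𝒫ₙ have
-- length ≤ n, fuel suc n is always sufficient (see μP below).
mobiusFuel : (n : ℕ) → ℕ → Subset n → Subset n → ℤ
mobiusFuel n zero    S T = 0ℤ
mobiusFuel n (suc k) S T with S ≟ˢ T
... | yes _ = 1ℤ
... | no _ with S ⊆? T
...   | no _  = 0ℤ
...   | yes _ = - sumℤ (map (λ U → mobiusFuel n k S U)
                          (filter (λ U → (S ⊆? U) ×-dec ((U ⊆? T) ×-dec ¬? (U ≟ˢ T)))
                                  (elemsP n)))

μP : (n : ℕ) → Subset n → Subset n → ℤ
μP n S T = mobiusFuel n (suc n) S T

-- 𝒫ₙ is a down-set of the Boolean lattice of subsets of [n].  A set U is a peak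
-- set exactly when every y ∈ U has at least two more non-members than members of
-- U below it.  Necessity: the letters ≤ y of a word form maximal runs in which
-- peaks and non-peaks alternate, starting and ending with a non-peak, so a word
-- with p ≥ 1 peaks ≤ y has more than 2p letters ≤ y.  Sufficiency: interleaving
-- the increasing lists of non-members and members of U gives a permutation with
-- peak set U.  The condition visibly passes to subsets.  Hence every interval
-- [S, T] of 𝒫ₙ is a full Boolean interval, and induction on ∣T∣ − ∣S∣ reduces the
-- recursion for μ to the vanishing of Σ_{S ⊆ U ⊆ T} (−1)^(∣U∣−∣S∣) when S ⊊ T.

module Submission where

open import Defs
open import Data.Fin.Subset using (Subset; _⊆_; ∣_∣)
open import Data.Fin.Subset.Properties using (∣p∣≤n)
open import Data.Integer using (-1ℤ; _^_)
open import Data.Nat using (ℕ; _≤_; _∸_)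
open import Data.Nat.Properties using (≤-trans; m∸n≤m)
open import Relation.Binary.PropositionalEquality using (_≡_)

module PeakSets where
  open import Data.Bool using (Bool; true)
  open import Data.Bool.Properties using (∧-zeroʳ)
  open import Data.Empty using (⊥; ⊥-elim)
  open import Data.Fin using (Fin; _<?_; _≤?_) renaming (_<_ to _<ᶠ_; _≤_ to _≤ᶠ_)
  import Data.Fin.Properties as Fin
  open import Data.Fin.Properties using () renaming (_≟_ to _≟ᶠ_)
  open import Data.Fin.Subset using (_∈_)
  open import Data.Fin.Subset.Properties using (_∈?_; ⊆-antisym)
  open import Data.List using (List; []; _∷_; _++_; map; filter; length; allFin)
  open import Data.List.Membership.Propositional using (find; lose) renaming (_∈_ to _∈ₗ_)
  open import Data.List.Membership.Propositional.Properties
    using (∈-filter⁺; ∈-filter⁻; ∈-allFin; ∈-++⁺ˡ; ∈-++⁺ʳ; ∈-++⁻; ∈-∃++; ∈-map⁺; ∈-concatMap⁺)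
  open import Data.List.Properties
    using (length-++; length-tabulate; length-filter; filter-accept; filter-reject; filter-none)
  open import Data.List.Relation.Binary.Permutation.Propositional
    using (_↭_; prep; ↭-refl; ↭-sym; ↭-trans; ↭⇒↭ₛ)
  open import Data.List.Relation.Binary.Permutation.Propositional.Properties
    using (shift; ++-identityʳ; ↭-length)
  import Data.List.Relation.Binary.Permutation.Setoid.Properties as Permutationₛ
  open import Data.List.Relation.Binary.Sublist.Propositional using (⊆-refl) renaming (_⊆_ to _⊑_)
  import Data.List.Relation.Binary.Sublist.Propositional.Properties as Sublist
  open import Data.List.Relation.Unary.All as All using (All; []; _∷_)
  open import Data.List.Relation.Unary.AllPairs using (AllPairs; []; _∷_)
  import Data.List.Relation.Unary.AllPairs.Properties as AllPairs
  open import Data.List.Relation.Unary.Any as Any using (Any; here; there; any?)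
  open import Data.List.Relation.Unary.Unique.Propositional using (Unique)
  import Data.List.Relation.Unary.Unique.Propositional.Properties as Unique
  import Data.List.Relation.Unary.Unique.DecPropositional as UniqueDec
  open import Data.Nat using (zero; suc; _+_; _<_; z≤n; s≤s)
  import Data.Nat.Properties as ℕ
  open import Function using (_∘_; id)
  open import Data.Product using (_×_; _,_; proj₂)
  open import Data.Sum using (_⊎_; inj₁; inj₂)
  open import Data.Unit using (⊤; tt)
  open import Data.Vec using (lookup)
  open import Data.Vec.Properties using (lookup∘tabulate; []=⇒lookup; lookup⇒[]=)
  open import Relation.Nullary using (yes; no; ¬_; does; ¬?)
  open import Relation.Nullary.Decidable using (⌊_⌋; isYes≗does; dec-true; dec-false)
  open import Relation.Unary using (Decidable)
  open import Relation.Binary.PropositionalEquality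

  module _ {A : Set} where

    Unique-⊆⇒length≤ : ∀ {xs ys : List A} → Unique xs → (∀ {x} → x ∈ₗ xs → x ∈ₗ ys) →
      length xs ≤ length ys
    Unique-⊆⇒length≤ {[]}     _            _     = z≤n
    Unique-⊆⇒length≤ {x ∷ xs} (x∉xs ∷ xs!) xs⊆ys
      with as , bs , refl ← ∈-∃++ (xs⊆ys (here refl)) =
      ℕ.≤-trans (s≤s (Unique-⊆⇒length≤ xs! xs⊆as++bs)) (ℕ.≤-reflexive (sym (↭-length (shift x as bs))))
      where
      xs⊆as++bs : ∀ {y} → y ∈ₗ xs → y ∈ₗ as ++ bs
      xs⊆as++bs y∈xs with ∈-++⁻ as (xs⊆ys (there y∈xs))
      ... | inj₁ y∈as         = ∈-++⁺ˡ y∈as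
      ... | inj₂ (here refl)  = ⊥-elim (All.lookup x∉xs y∈xs refl)
      ... | inj₂ (there y∈bs) = ∈-++⁺ʳ as y∈bs

    filter-∁-++-filter-↭ : ∀ {P : A → Set} (P? : Decidable P) xs →
      filter (λ x → ¬? (P? x)) xs ++ filter P? xs ↭ xs
    filter-∁-++-filter-↭ P? [] = ↭-refl
    filter-∁-++-filter-↭ P? (x ∷ xs) with P? x
    ... | yes _ = ↭-trans (shift x (filter (λ x → ¬? (P? x)) xs) (filter P? xs))
                          (prep x (filter-∁-++-filter-↭ P? xs))
    ... | no _  = prep x (filter-∁-++-filter-↭ P? xs)

  module _ {n : ℕ} where

    peakValues-peak : ∀ {a b c : Fin n} r → a <ᶠ b → c <ᶠ b →
      peakValues (a ∷ b ∷ c ∷ r) ≡ b ∷ peakValues (b ∷ c ∷ r)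
    peakValues-peak {a} {b} {c} r a<b c<b
      rewrite dec-true (a <? b) a<b | dec-true (c <? b) c<b = refl

    peakValues-notPeakˡ : ∀ {a b c : Fin n} r → ¬ a <ᶠ b →
      peakValues (a ∷ b ∷ c ∷ r) ≡ peakValues (b ∷ c ∷ r)
    peakValues-notPeakˡ {a} {b} r a≮b rewrite dec-false (a <? b) a≮b = refl

    peakValues-notPeakʳ : ∀ {a b c : Fin n} r → ¬ c <ᶠ b →
      peakValues (a ∷ b ∷ c ∷ r) ≡ peakValues (b ∷ c ∷ r)
    peakValues-notPeakʳ {a} {b} {c} r c≮b
      rewrite dec-false (c <? b) c≮b | ∧-zeroʳ (does (a <? b)) = refl

    peakValues-descent : ∀ {b c : Fin n} r → c <ᶠ b → peakValues (b ∷ c ∷ r) ≡ peakValues (c ∷ r)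
    peakValues-descent []      _   = refl
    peakValues-descent (d ∷ r) c<b = peakValues-notPeakˡ r (Fin.<-asym c<b)

  module LowPeaks {n : ℕ} (t : Fin n) where

    low : List (Fin n) → ℕ
    low w = length (filter (_≤? t) w)

    lowPeaks : List (Fin n) → ℕ
    lowPeaks w = low (peakValues w)

    StartsLow : List (Fin n) → Set
    StartsLow []      = ⊥
    StartsLow (a ∷ _) = a ≤ᶠ t

    -- The disjunct StartsLow w is what the induction needs: a low peak is
    -- followed by a low letter, which starts the remaining word.
    Bound : List (Fin n) → Set
    Bound w = (lowPeaks w + lowPeaks w ≤ low w)
            × (StartsLow w ⊎ 0 < lowPeaks w → lowPeaks w + lowPeaks w < low w)

    low-accept : ∀ {a} w → a ≤ᶠ t → low (a ∷ w) ≡ suc (low w)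
    low-accept w a≤t = cong length (filter-accept (_≤? t) a≤t)

    low-reject : ∀ {a} w → ¬ a ≤ᶠ t → low (a ∷ w) ≡ low w
    low-reject w a≰t = cong length (filter-reject (_≤? t) a≰t)

    bound-∷ : ∀ a w → lowPeaks (a ∷ w) ≡ lowPeaks w → Bound w → Bound (a ∷ w)
    bound-∷ a w same-peaks (bound , strict) rewrite same-peaks with a ≤? t
    ... | yes a≤t rewrite low-accept w a≤t = ℕ.m≤n⇒m≤1+n bound , λ _ → s≤s bound
    ... | no a≰t rewrite low-reject w a≰t = bound , λ where
      (inj₁ a≤t)     → ⊥-elim (a≰t a≤t)
      (inj₂ 0<peaks) → strict (inj₂ 0<peaks)

    module _ {a b c : Fin n} (r : List (Fin n)) (a<b : a <ᶠ b) (c<b : c <ᶠ b) (b≤t : b ≤ᶠ t) where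

      lowPeaks-lowPeak : lowPeaks (a ∷ b ∷ c ∷ r) ≡ suc (lowPeaks (c ∷ r))
      lowPeaks-lowPeak = begin
        low (peakValues (a ∷ b ∷ c ∷ r))   ≡⟨ cong low (peakValues-peak r a<b c<b) ⟩
        low (b ∷ peakValues (b ∷ c ∷ r))   ≡⟨ low-accept _ b≤t ⟩
        suc (low (peakValues (b ∷ c ∷ r))) ≡⟨ cong (suc ∘ low) (peakValues-descent r c<b) ⟩
        suc (lowPeaks (c ∷ r))             ∎
        where open ≡-Reasoning

      low-lowPeak : low (a ∷ b ∷ c ∷ r) ≡ suc (suc (low (c ∷ r)))
      low-lowPeak = trans (low-accept _ (Fin.≤-trans (ℕ.<⇒≤ a<b) b≤t)) (cong suc (low-accept _ b≤t))

      bound-lowPeak : Bound (c ∷ r) → Bound (a ∷ b ∷ c ∷ r)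
      bound-lowPeak (_ , strict) rewrite lowPeaks-lowPeak | low-lowPeak =
        ℕ.<⇒≤ two-more , λ _ → two-more
        where
        p = lowPeaks (c ∷ r)
        c-low : p + p < low (c ∷ r)
        c-low = strict (inj₁ (Fin.≤-trans (ℕ.<⇒≤ c<b) b≤t))
        two-more : suc p + suc p < suc (suc (low (c ∷ r)))
        two-more = s≤s (subst (_< suc (low (c ∷ r))) (sym (ℕ.+-suc p p)) (s≤s c-low))

    bound-step : ∀ a b c r → Bound (b ∷ c ∷ r) → Bound (c ∷ r) → Bound (a ∷ b ∷ c ∷ r)
    bound-step a b c r bound-bcr bound-cr with a <? b | c <? b | b ≤? t
    ... | no a≮b  | _       | _       = bound-∷ a _ (cong low (peakValues-notPeakˡ r a≮b)) bound-bcr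
    ... | yes _   | no c≮b  | _       = bound-∷ a _ (cong low (peakValues-notPeakʳ r c≮b)) bound-bcr
    ... | yes a<b | yes c<b | no b≰t  =
      bound-∷ a _ (trans (cong low (peakValues-peak r a<b c<b)) (low-reject _ b≰t)) bound-bcr
    ... | yes a<b | yes c<b | yes b≤t = bound-lowPeak r a<b c<b b≤t bound-cr

    bound : ∀ w → Bound w
    bound []              = z≤n , λ { (inj₁ ()) ; (inj₂ ()) }
    bound (a ∷ [])        = bound-∷ a [] refl (bound [])
    bound (a ∷ b ∷ [])    = bound-∷ a (b ∷ []) refl (bound (b ∷ []))
    bound (a ∷ b ∷ c ∷ r) = bound-step a b c r (bound (b ∷ c ∷ r)) (bound (c ∷ r))

  module _ {n : ℕ} where

    members : Subset n → List (Fin n)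
    members U = filter (_∈? U) (allFin n)

    nonMembers : Subset n → List (Fin n)
    nonMembers U = filter (λ x → ¬? (x ∈? U)) (allFin n)

    ∈-members⁺ : ∀ {U x} → x ∈ U → x ∈ₗ members U
    ∈-members⁺ {U} = ∈-filter⁺ (_∈? U) {xs = allFin n} (∈-allFin _)

    ∈-members⁻ : ∀ {U x} → x ∈ₗ members U → x ∈ U
    ∈-members⁻ {U} x∈ = proj₂ (∈-filter⁻ (_∈? U) {xs = allFin n} x∈)

    ∈-nonMembers⁺ : ∀ {U x} → ¬ x ∈ U → x ∈ₗ nonMembers U
    ∈-nonMembers⁺ {U} = ∈-filter⁺ (λ x → ¬? (x ∈? U)) {xs = allFin n} (∈-allFin _)

    countBelow : Fin n → List (Fin n) → ℕ
    countBelow y xs = length (filter (_<? y) xs)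

    Admissible : Subset n → Set
    Admissible U = ∀ {y} → y ∈ U → 2 + countBelow y (members U) ≤ countBelow y (nonMembers U)

    Admissible-⊆ : ∀ {T U} → Admissible T → U ⊆ T → Admissible U
    Admissible-⊆ {T} {U} adm U⊆T {y} y∈U = begin
      2 + countBelow y (members U) ≤⟨ ℕ.+-monoʳ-≤ 2 (Sublist.length-mono-≤ (below members-⊆)) ⟩
      2 + countBelow y (members T) ≤⟨ adm (U⊆T y∈U) ⟩
      countBelow y (nonMembers T)  ≤⟨ Sublist.length-mono-≤ (below nonMembers-⊇) ⟩
      countBelow y (nonMembers U)  ∎
      where
      open ℕ.≤-Reasoning
      below : ∀ {xs ys} → xs ⊑ ys → filter (_<? y) xs ⊑ filter (_<? y) ys
      below = Sublist.filter⁺ (_<? y) (_<? y) (λ { refl x<y → x<y })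
      members-⊆ : members U ⊑ members T
      members-⊆ = Sublist.filter⁺ (_∈? U) (_∈? T) (λ { refl x∈U → U⊆T x∈U })
                    (⊆-refl {x = allFin n})
      nonMembers-⊇ : nonMembers T ⊑ nonMembers U
      nonMembers-⊇ = Sublist.filter⁺ (λ x → ¬? (x ∈? T)) (λ x → ¬? (x ∈? U))
                       (λ { refl x∉T x∈U → x∉T (U⊆T x∈U) }) (⊆-refl {x = allFin n})

    private
      isPeak : List (Fin n) → Fin n → Bool
      isPeak σ v = ⌊ any? (λ p → p ≟ᶠ v) (peakValues σ) ⌋

    ∈-CP⁻ : ∀ σ {y} → y ∈ CP σ → y ∈ₗ peakValues σ
    ∈-CP⁻ σ {y} y∈CP with any? (λ p → p ≟ᶠ y) (peakValues σ)
                        | trans (sym (lookup∘tabulate (isPeak σ) y)) ([]=⇒lookup y∈CP)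
    ... | yes y∈peaks | _ = Any.map sym y∈peaks
    ... | no _        | ()

    ∈-CP⁺ : ∀ σ {y} → y ∈ₗ peakValues σ → y ∈ CP σ
    ∈-CP⁺ σ {y} y∈peaks = lookup⇒[]= y (CP σ) (begin
      lookup (CP σ) y ≡⟨ lookup∘tabulate (isPeak σ) y ⟩
      ⌊ y-peak? ⌋     ≡⟨ isYes≗does y-peak? ⟩
      does y-peak?    ≡⟨ dec-true y-peak? (Any.map sym y∈peaks) ⟩
      true            ∎)
      where
      open ≡-Reasoning
      y-peak? = any? (λ p → p ≟ᶠ y) (peakValues σ)

    CP-admissible : ∀ {σ} → Unique σ → Admissible (CP σ)
    CP-admissible {σ} σ! {y} y∈T = ℕ.+-cancelʳ-≤ u (2 + u) m (ℕ.≤-pred (begin-strict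
      suc (suc u) + u         ≡⟨ cong suc (ℕ.+-suc u u) ⟨
      suc u + suc u           ≤⟨ ℕ.+-mono-≤ peaks-lower peaks-lower ⟩
      lowPeaks σ + lowPeaks σ <⟨ proj₂ (bound σ) (inj₂ (ℕ.<-≤-trans (s≤s z≤n) peaks-lower)) ⟩
      low σ                   ≤⟨ low-upper ⟩
      suc (m + u)             ∎))
      where
      open LowPeaks y
      open ℕ.≤-Reasoning
      T = CP σ
      belowᵀ = filter (_<? y) (members T)
      belowᶜ = filter (_<? y) (nonMembers T)
      u = length belowᵀ
      m = length belowᶜ

      ∈-belowᵀ⁻ : ∀ {x} → x ∈ₗ belowᵀ → x ∈ T × x <ᶠ y
      ∈-belowᵀ⁻ x∈ with x∈T , x<y ← ∈-filter⁻ (_<? y) {xs = members T} x∈ = ∈-members⁻ x∈T , x<y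

      y∷belowᵀ! : Unique (y ∷ belowᵀ)
      y∷belowᵀ! = All.tabulate (λ x∈ y≡x → Fin.<-irrefl (sym y≡x) (proj₂ (∈-belowᵀ⁻ x∈)))
                ∷ Unique.filter⁺ (_<? y) {xs = members T} (Unique.filter⁺ (_∈? T) (Unique.allFin⁺ n))

      y∷belowᵀ⊆peaks : ∀ {x} → x ∈ₗ y ∷ belowᵀ → x ∈ₗ filter (_≤? y) (peakValues σ)
      y∷belowᵀ⊆peaks (here refl) = ∈-filter⁺ (_≤? y) (∈-CP⁻ σ y∈T) Fin.≤-refl
      y∷belowᵀ⊆peaks (there x∈)  with x∈T , x<y ← ∈-belowᵀ⁻ x∈ =
        ∈-filter⁺ (_≤? y) (∈-CP⁻ σ x∈T) (ℕ.<⇒≤ x<y)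

      peaks-lower : suc u ≤ lowPeaks σ
      peaks-lower = Unique-⊆⇒length≤ y∷belowᵀ! y∷belowᵀ⊆peaks

      ≢y⇒<y : ∀ {x} → x ∈ₗ filter (_≤? y) σ → x ≢ y → x <ᶠ y
      ≢y⇒<y x∈ = Fin.≤∧≢⇒< (proj₂ (∈-filter⁻ (_≤? y) {xs = σ} x∈))

      low⊆y∷below : ∀ {x} → x ∈ₗ filter (_≤? y) σ → x ∈ₗ y ∷ (belowᶜ ++ belowᵀ)
      low⊆y∷below {x} x∈ with x ≟ᶠ y | x ∈? T
      ... | yes refl | _       = here refl
      ... | no x≢y   | yes x∈T =
        there (∈-++⁺ʳ belowᶜ (∈-filter⁺ (_<? y) (∈-members⁺ x∈T) (≢y⇒<y x∈ x≢y)))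
      ... | no x≢y   | no x∉T  =
        there (∈-++⁺ˡ (∈-filter⁺ (_<? y) (∈-nonMembers⁺ x∉T) (≢y⇒<y x∈ x≢y)))

      low-upper : low σ ≤ suc (m + u)
      low-upper = ℕ.≤-trans (Unique-⊆⇒length≤ (Unique.filter⁺ (_≤? y) {xs = σ} σ!) low⊆y∷below)
                            (ℕ.≤-reflexive (cong suc (length-++ belowᶜ)))

  module _ {A : Set} where

    zigzag : List A → List A → List A
    zigzag (x ∷ xs) (y ∷ ys) = x ∷ y ∷ zigzag xs ys
    zigzag xs       []       = xs
    zigzag []       ys       = ys

    zigzag-identityʳ : ∀ xs → zigzag xs [] ≡ xs
    zigzag-identityʳ []       = refl
    zigzag-identityʳ (x ∷ xs) = refl

    zigzag-↭ : ∀ xs ys → zigzag xs ys ↭ xs ++ ys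
    zigzag-↭ (x ∷ xs) (y ∷ ys) = prep x (↭-trans (prep y (zigzag-↭ xs ys)) (↭-sym (shift y xs ys)))
    zigzag-↭ []       []       = ↭-refl
    zigzag-↭ (x ∷ xs) []       = ↭-sym (++-identityʳ (x ∷ xs))
    zigzag-↭ []       (y ∷ ys) = ↭-refl

  module _ {n : ℕ} where

    Increasing : List (Fin n) → Set
    Increasing = AllPairs _<ᶠ_

    Alternates : List (Fin n) → List (Fin n) → Set
    Alternates xs            []       = ⊤
    Alternates (x ∷ x' ∷ xs) (y ∷ ys) = x <ᶠ y × x' <ᶠ y × Alternates (x' ∷ xs) ys
    Alternates _             (_ ∷ _)  = ⊥

    peakValues-increasing : ∀ {xs} → Increasing xs → peakValues xs ≡ []
    peakValues-increasing {[]}          _ = refl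
    peakValues-increasing {a ∷ []}      _ = refl
    peakValues-increasing {a ∷ b ∷ []}  _ = refl
    peakValues-increasing {a ∷ b ∷ c ∷ r} (_ ∷ b<c∷r ∷ inc) = trans
      (peakValues-notPeakʳ r (Fin.<-asym (All.head b<c∷r))) (peakValues-increasing (b<c∷r ∷ inc))

    peakValues-valley-peak : ∀ {x y x' : Fin n} r → x <ᶠ y → x' <ᶠ y →
      peakValues (x ∷ y ∷ x' ∷ r) ≡ y ∷ peakValues (x' ∷ r)
    peakValues-valley-peak r x<y x'<y =
      trans (peakValues-peak r x<y x'<y) (cong (_ ∷_) (peakValues-descent r x'<y))

    peakValues-zigzag : ∀ {xs ys} → Increasing xs → Alternates xs ys → peakValues (zigzag xs ys) ≡ ys
    peakValues-zigzag {xs}          {[]}          inc _ =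
      trans (cong peakValues (zigzag-identityʳ xs)) (peakValues-increasing inc)
    peakValues-zigzag {x ∷ x' ∷ xs} {y ∷ []}      (_ ∷ inc) (x<y , x'<y , _) =
      trans (peakValues-valley-peak xs x<y x'<y) (cong (y ∷_) (peakValues-increasing inc))
    peakValues-zigzag {x ∷ x' ∷ xs} {y ∷ y' ∷ ys} (_ ∷ inc) (x<y , x'<y , alt) =
      trans (peakValues-valley-peak (y' ∷ zigzag xs ys) x<y x'<y) (cong (y ∷_) (peakValues-zigzag inc alt))

    countBelow-∷-< : ∀ (y : Fin n) {x} xs → x <ᶠ y →
      countBelow y (x ∷ xs) ≡ suc (countBelow y xs)
    countBelow-∷-< y {x} xs x<y = cong length (filter-accept (_<? y) {x} x<y)

    countBelow-∷ : ∀ (y x : Fin n) xs → countBelow y (x ∷ xs) ≤ suc (countBelow y xs)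
    countBelow-∷ y x xs with x <? y
    ... | yes x<y = ℕ.≤-reflexive (countBelow-∷-< y xs x<y)
    ... | no x≮y  =
      ℕ.≤-trans (ℕ.≤-reflexive (cong length (filter-reject (_<? y) {x} x≮y))) (ℕ.n≤1+n _)

    countBelow-increasing : ∀ (y : Fin n) {x'} xs → ¬ x' <ᶠ y → Increasing (x' ∷ xs) →
      countBelow y (x' ∷ xs) ≡ 0
    countBelow-increasing y xs x'≮y (x'<xs ∷ _) = cong length
      (filter-none (_<? y) (x'≮y ∷ All.map (λ x'<x x<y → x'≮y (Fin.<-trans x'<x x<y)) x'<xs))

    countBelow-≤1 : ∀ (y x : Fin n) {x'} xs → ¬ x' <ᶠ y → Increasing (x' ∷ xs) →
      countBelow y (x ∷ x' ∷ xs) ≤ 1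
    countBelow-≤1 y x {x'} xs x'≮y inc = subst (countBelow y (x ∷ x' ∷ xs) ≤_)
      (cong suc (countBelow-increasing y xs x'≮y inc)) (countBelow-∷ y x (x' ∷ xs))

    alternates : ∀ {xs ys} → Increasing xs → Increasing ys →
      (∀ {y} → y ∈ₗ ys → 2 + countBelow y ys ≤ countBelow y xs) → Alternates xs ys
    alternates {xs}          {[]}     _ _ _ = tt
    alternates {[]}          {y ∷ ys} _ _ enough with () ← enough (here refl)
    alternates {x ∷ []}      {y ∷ ys} _ _ enough
      with s≤s () ← ℕ.≤-trans (enough (here refl)) (length-filter (_<? y) (x ∷ []))
    alternates {x ∷ x' ∷ xs} {y ∷ ys} (x<x'∷xs ∷ inc) (y<ys ∷ incʸ) enough with x' <? y
    ... | no x'≮y with s≤s () ← ℕ.≤-trans (enough (here refl)) (countBelow-≤1 y x xs x'≮y inc)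
    ... | yes x'<y = x<y , x'<y , alternates inc incʸ enough'
      where
      x<y : x <ᶠ y
      x<y = Fin.<-trans (All.head x<x'∷xs) x'<y
      enough' : ∀ {y'} → y' ∈ₗ ys → 2 + countBelow y' ys ≤ countBelow y' (x' ∷ xs)
      enough' {y'} y'∈ys = ℕ.≤-pred (subst₂ _≤_
        (cong (2 +_) (countBelow-∷-< y' ys y<y'))
        (countBelow-∷-< y' (x' ∷ xs) (Fin.<-trans x<y y<y'))
        (enough (there y'∈ys)))
        where y<y' = All.lookup y<ys y'∈ys

    Increasing-allFin : Increasing (allFin n)
    Increasing-allFin = AllPairs.tabulate⁺-< (λ i<j → i<j)

    ∈-words : ∀ m {w : List (Fin n)} → length w ≡ m → w ∈ₗ words n m
    ∈-words zero    {[]}    refl = here refl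
    ∈-words (suc m) {x ∷ w} refl = ∈-concatMap⁺ (λ w' → map (_∷ w') (allFin n))
      (Any.map (λ { refl → ∈-map⁺ (_∷ w) (∈-allFin x) }) (∈-words m refl))

    ∈-perms⇒Unique : ∀ {σ} → σ ∈ₗ perms n → Unique σ
    ∈-perms⇒Unique σ∈ =
      proj₂ (∈-filter⁻ (λ σ → UniqueDec.unique? (_≟ᶠ_ {n}) σ) {xs = words n n} σ∈)

    Admissible⇒InP : ∀ {U} → Admissible U → InP n U
    Admissible⇒InP {U} adm = lose σ∈perms CP-σ
      where
      σ = zigzag (nonMembers U) (members U)
      increasingᶜ : Increasing (nonMembers U)
      increasingᶜ = AllPairs.filter⁺ (λ x → ¬? (x ∈? U)) Increasing-allFin
      peaks-σ : peakValues σ ≡ members U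
      peaks-σ = peakValues-zigzag increasingᶜ
        (alternates increasingᶜ (AllPairs.filter⁺ (_∈? U) Increasing-allFin)
                    (λ y∈ → adm (∈-members⁻ y∈)))
      CP-σ : CP σ ≡ U
      CP-σ = ⊆-antisym (λ y∈CP → ∈-members⁻ (subst (_ ∈ₗ_) peaks-σ (∈-CP⁻ σ y∈CP)))
                       (λ y∈U → ∈-CP⁺ σ (subst (_ ∈ₗ_) (sym peaks-σ) (∈-members⁺ y∈U)))
      allFin↭σ : allFin n ↭ σ
      allFin↭σ = ↭-sym (↭-trans (zigzag-↭ (nonMembers U) (members U))
                                (filter-∁-++-filter-↭ (_∈? U) (allFin n)))
      σ∈perms : σ ∈ₗ perms n
      σ∈perms = ∈-filter⁺ (λ σ → UniqueDec.unique? (_≟ᶠ_ {n}) σ)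
        (∈-words n (trans (sym (↭-length allFin↭σ)) (length-tabulate id)))
        (Permutationₛ.Unique-resp-↭ (setoid (Fin n)) (↭⇒↭ₛ allFin↭σ) (Unique.allFin⁺ n))

    InP⇒Admissible : ∀ {T} → InP n T → Admissible T
    InP⇒Admissible T∈𝒫 with σ , σ∈perms , refl ← find T∈𝒫 =
      CP-admissible (∈-perms⇒Unique σ∈perms)

    InP-⊆ : ∀ {T U} → InP n T → U ⊆ T → InP n U
    InP-⊆ T∈𝒫 U⊆T = Admissible⇒InP (Admissible-⊆ (InP⇒Admissible T∈𝒫) U⊆T)

module Möbius where
  open import Algebra.Properties.CommutativeSemigroup using (interchange)
  open import Data.Bool using (true; false; if_then_else_; _∧_)
  open import Data.Bool.Properties using (∧-zeroʳ)
  open import Data.Empty using (⊥-elim)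
  open import Data.Fin.Subset.Properties using (_⊆?_; ⊆-refl; drop-∷-⊆; p⊆q⇒∣p∣≤∣q∣)
  open import Data.Integer using (ℤ; 0ℤ; -_; _+_)
  open import Data.Integer.Properties using
    ( +-identityˡ; +-identityʳ; +-assoc; +-inverseˡ; +-inverseʳ; neg-distrib-+; neg-involutive
    ; -1*i≡-i; +-commutativeSemigroup)
  open import Data.List using ([]; _∷_; _++_; map; filter)
  open import Data.List.Properties using (map-++; map-∘; map-cong)
  open import Data.List.Relation.Unary.Any using (any?)
  open import Data.Nat using (zero; suc; _<_; s≤s)
  open import Data.Nat.Properties using (n∸n≡0; +-∸-assoc; ≤-pred; <⇒≱; m<n⇒0<n∸m; ∸-monoˡ-<)
  open import Data.Vec using ([]; _∷_; here)
  open import Function using (_∘_)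
  open import Relation.Nullary using (yes; no; does; ¬?)
  open import Relation.Nullary.Decidable using (_×-dec_)
  open import Relation.Unary using (Decidable)
  open import Relation.Binary.PropositionalEquality

  sumℤ-++ : ∀ xs ys → sumℤ (xs ++ ys) ≡ sumℤ xs + sumℤ ys
  sumℤ-++ []       ys = sym (+-identityˡ _)
  sumℤ-++ (x ∷ xs) ys = trans (cong (x +_) (sumℤ-++ xs ys)) (sym (+-assoc x _ _))

  module _ {A : Set} where

    sumℤ-map-neg : ∀ (f : A → ℤ) xs → sumℤ (map (λ x → - f x) xs) ≡ - sumℤ (map f xs)
    sumℤ-map-neg f []       = refl
    sumℤ-map-neg f (x ∷ xs) =
      trans (cong (- f x +_) (sumℤ-map-neg f xs)) (sym (neg-distrib-+ (f x) _))

    sumℤ-map-+ : ∀ (f g : A → ℤ) xs →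
      sumℤ (map (λ x → f x + g x) xs) ≡ sumℤ (map f xs) + sumℤ (map g xs)
    sumℤ-map-+ f g []       = refl
    sumℤ-map-+ f g (x ∷ xs) = trans (cong (f x + g x +_) (sumℤ-map-+ f g xs))
                                    (interchange +-commutativeSemigroup (f x) (g x) _ _)

    sumℤ-map-filter : ∀ {P : A → Set} (P? : Decidable P) (f : A → ℤ) xs →
      sumℤ (map f (filter P? xs)) ≡ sumℤ (map (λ x → if does (P? x) then f x else 0ℤ) xs)
    sumℤ-map-filter P? f []       = refl
    sumℤ-map-filter P? f (x ∷ xs) with does (P? x)
    ... | true  = cong (f x +_) (sumℤ-map-filter P? f xs)
    ... | false = trans (sumℤ-map-filter P? f xs) (sym (+-identityˡ _))

  sumSubsets : (n : ℕ) → (Subset n → ℤ) → ℤ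
  sumSubsets n f = sumℤ (map f (subsets n))

  sumSubsets-suc : ∀ n (f : Subset (suc n) → ℤ) →
    sumSubsets (suc n) f ≡ sumSubsets n (f ∘ (true ∷_)) + sumSubsets n (f ∘ (false ∷_))
  sumSubsets-suc n f = begin
    sumℤ (map f (map (true ∷_) (subsets n) ++ map (false ∷_) (subsets n)))
      ≡⟨ cong sumℤ (map-++ f (map (true ∷_) (subsets n)) _) ⟩
    sumℤ (map f (map (true ∷_) (subsets n)) ++ map f (map (false ∷_) (subsets n)))
      ≡⟨ sumℤ-++ (map f (map (true ∷_) (subsets n))) _ ⟩
    sumℤ (map f (map (true ∷_) (subsets n))) + sumℤ (map f (map (false ∷_) (subsets n)))
      ≡⟨ cong₂ _+_ (cong sumℤ (sym (map-∘ (subsets n)))) (cong sumℤ (sym (map-∘ (subsets n)))) ⟩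
    sumSubsets n (f ∘ (true ∷_)) + sumSubsets n (f ∘ (false ∷_)) ∎
    where open ≡-Reasoning

  sumSubsets-cong : ∀ n {f g : Subset n → ℤ} → (∀ U → f U ≡ g U) →
    sumSubsets n f ≡ sumSubsets n g
  sumSubsets-cong n f≗g = cong sumℤ (map-cong f≗g (subsets n))

  sumSubsets-0 : ∀ n → sumSubsets n (λ _ → 0ℤ) ≡ 0ℤ
  sumSubsets-0 zero    = refl
  sumSubsets-0 (suc n) = trans (sumSubsets-suc n _) (cong₂ _+_ (sumSubsets-0 n) (sumSubsets-0 n))

  sumSubsets-indicator : ∀ n (T : Subset n) (g : Subset n → ℤ) →
    sumSubsets n (λ U → if does (U ≟ˢ T) then g U else 0ℤ) ≡ g T
  sumSubsets-indicator zero    []          g = +-identityʳ (g [])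
  sumSubsets-indicator (suc n) (true ∷ T)  g = begin
    _ ≡⟨ sumSubsets-suc n _ ⟩
    _ ≡⟨ cong₂ _+_ (sumSubsets-indicator n T (g ∘ (true ∷_))) (sumSubsets-0 n) ⟩
    _ ≡⟨ +-identityʳ _ ⟩
    g (true ∷ T) ∎
    where open ≡-Reasoning
  sumSubsets-indicator (suc n) (false ∷ T) g = begin
    _ ≡⟨ sumSubsets-suc n _ ⟩
    _ ≡⟨ cong₂ _+_ (sumSubsets-0 n) (sumSubsets-indicator n T (g ∘ (false ∷_))) ⟩
    _ ≡⟨ +-identityˡ _ ⟩
    g (false ∷ T) ∎
    where open ≡-Reasoning

  -1ℤ^suc : ∀ m → -1ℤ ^ suc m ≡ - (-1ℤ ^ m)
  -1ℤ^suc m = -1*i≡-i (-1ℤ ^ m)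

  ∷-≢ : ∀ {n} {b} {S T : Subset n} → b ∷ S ≢ b ∷ T → S ≢ T
  ∷-≢ b∷S≢b∷T refl = b∷S≢b∷T refl

  ⊂⇒∣∣< : ∀ {n} {S T : Subset n} → S ⊆ T → S ≢ T → ∣ S ∣ < ∣ T ∣
  ⊂⇒∣∣< {S = []}        {[]}        _   S≢T = ⊥-elim (S≢T refl)
  ⊂⇒∣∣< {S = true ∷ S}  {true ∷ T}  S⊆T S≢T = s≤s (⊂⇒∣∣< (drop-∷-⊆ S⊆T) (∷-≢ S≢T))
  ⊂⇒∣∣< {S = false ∷ S} {false ∷ T} S⊆T S≢T = ⊂⇒∣∣< (drop-∷-⊆ S⊆T) (∷-≢ S≢T)
  ⊂⇒∣∣< {S = false ∷ S} {true ∷ T}  S⊆T _   = s≤s (p⊆q⇒∣p∣≤∣q∣ (drop-∷-⊆ S⊆T))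
  ⊂⇒∣∣< {S = true ∷ S}  {false ∷ T} S⊆T _   with () ← S⊆T here

  intervalSign : ∀ {n} → Subset n → Subset n → Subset n → ℤ
  intervalSign S T U = if does (S ⊆? U) ∧ does (U ⊆? T) then -1ℤ ^ (∣ U ∣ ∸ ∣ S ∣) else 0ℤ

  sumSubsets-intervalSign : ∀ n {S T : Subset n} → S ⊆ T → S ≢ T →
    sumSubsets n (intervalSign S T) ≡ 0ℤ
  sumSubsets-intervalSign zero {[]} {[]} _ S≢T = ⊥-elim (S≢T refl)
  sumSubsets-intervalSign (suc n) {true ∷ S} {true ∷ T} S⊆T S≢T = begin
    _ ≡⟨ sumSubsets-suc n _ ⟩
    _ ≡⟨ cong₂ _+_ (sumSubsets-intervalSign n (drop-∷-⊆ S⊆T) (∷-≢ S≢T)) (sumSubsets-0 n) ⟩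
    0ℤ ∎
    where open ≡-Reasoning
  sumSubsets-intervalSign (suc n) {false ∷ S} {false ∷ T} S⊆T S≢T = begin
    _ ≡⟨ sumSubsets-suc n _ ⟩
    _ ≡⟨ cong (_+ sumSubsets n (intervalSign S T)) (sumSubsets-cong n λ U →
            cong (if_then -1ℤ ^ (suc ∣ U ∣ ∸ ∣ S ∣) else 0ℤ) (∧-zeroʳ (does (S ⊆? U)))) ⟩
    sumSubsets n (λ _ → 0ℤ) + sumSubsets n (intervalSign S T)
      ≡⟨ cong₂ _+_ (sumSubsets-0 n) (sumSubsets-intervalSign n (drop-∷-⊆ S⊆T) (∷-≢ S≢T)) ⟩
    0ℤ ∎
    where open ≡-Reasoning
  sumSubsets-intervalSign (suc n) {false ∷ S} {true ∷ T} S⊆T _ = begin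
    _ ≡⟨ sumSubsets-suc n _ ⟩
    _ ≡⟨ cong (_+ sumSubsets n (intervalSign S T)) (sumSubsets-cong n flip-sign) ⟩
    _ ≡⟨ cong (_+ sumSubsets n (intervalSign S T)) (sumℤ-map-neg (intervalSign S T) (subsets n)) ⟩
    _ ≡⟨ +-inverseˡ (sumSubsets n (intervalSign S T)) ⟩
    0ℤ ∎
    where
    open ≡-Reasoning
    flip-sign : ∀ U → intervalSign (false ∷ S) (true ∷ T) (true ∷ U) ≡ - intervalSign S T U
    flip-sign U with S ⊆? U | U ⊆? T
    ... | no _    | _     = refl
    ... | yes _   | no _  = refl
    ... | yes S⊆U | yes _ =
      trans (cong (-1ℤ ^_) (+-∸-assoc 1 (p⊆q⇒∣p∣≤∣q∣ S⊆U))) (-1ℤ^suc (∣ U ∣ ∸ ∣ S ∣))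
  sumSubsets-intervalSign (suc n) {true ∷ S} {false ∷ T} S⊆T _ with () ← S⊆T here

  DownClosed : ℕ → Set
  DownClosed n = ∀ {T U : Subset n} → InP n T → U ⊆ T → InP n U

  module _ {n : ℕ} (downClosed : DownClosed n) where

    sum-strictlyBetween : ∀ {S T} (f : Subset n → ℤ) → InP n T → S ⊆ T → S ≢ T →
      (∀ {U} → InP n U → S ⊆ U → U ⊆ T → U ≢ T → f U ≡ -1ℤ ^ (∣ U ∣ ∸ ∣ S ∣)) →
      sumℤ (map f (filter (λ U → (S ⊆? U) ×-dec ((U ⊆? T) ×-dec ¬? (U ≟ˢ T))) (elemsP n)))
        ≡ - (-1ℤ ^ (∣ T ∣ ∸ ∣ S ∣))
    sum-strictlyBetween {S} {T} f T∈𝒫 S⊆T S≢T f-sign = begin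
      sumℤ (map f (filter Between? (filter 𝒫? (subsets n))))
        ≡⟨ trans (sumℤ-map-filter Between? f (filter 𝒫? (subsets n)))
                 (sumℤ-map-filter 𝒫? _ (subsets n)) ⟩
      sumSubsets n (λ U → if does (𝒫? U) then (if does (Between? U) then f U else 0ℤ) else 0ℤ)
        ≡⟨ sumSubsets-cong n term ⟩
      sumSubsets n (λ U → intervalSign S T U + - atT U)
        ≡⟨ sumℤ-map-+ (intervalSign S T) (λ U → - atT U) (subsets n) ⟩
      sumSubsets n (intervalSign S T) + sumSubsets n (λ U → - atT U)
        ≡⟨ cong₂ _+_ (sumSubsets-intervalSign n S⊆T S≢T) (sumℤ-map-neg atT (subsets n)) ⟩
      0ℤ + - sumSubsets n atT
        ≡⟨ +-identityˡ _ ⟩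
      - sumSubsets n atT
        ≡⟨ cong -_ (sumSubsets-indicator n T _) ⟩
      - (-1ℤ ^ (∣ T ∣ ∸ ∣ S ∣)) ∎
      where
      open ≡-Reasoning
      𝒫? = λ U → any? (λ σ → CP σ ≟ˢ U) (perms n)
      Between? = λ U → (S ⊆? U) ×-dec ((U ⊆? T) ×-dec ¬? (U ≟ˢ T))
      atT : Subset n → ℤ
      atT U = if does (U ≟ˢ T) then -1ℤ ^ (∣ U ∣ ∸ ∣ S ∣) else 0ℤ
      term : ∀ U → (if does (𝒫? U) then (if does (Between? U) then f U else 0ℤ) else 0ℤ)
                   ≡ intervalSign S T U + - atT U
      term U with 𝒫? U | S ⊆? U | U ⊆? T | U ≟ˢ T
      ... | _       | _       | no T⊈T  | yes refl = ⊥-elim (T⊈T ⊆-refl)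
      ... | _       | no S⊈U  | _       | yes refl = ⊥-elim (S⊈U S⊆T)
      ... | yes _   | yes _   | yes _   | yes refl = sym (+-inverseʳ (-1ℤ ^ (∣ T ∣ ∸ ∣ S ∣)))
      ... | no _    | yes _   | yes _   | yes refl = sym (+-inverseʳ (-1ℤ ^ (∣ T ∣ ∸ ∣ S ∣)))
      ... | yes U∈𝒫 | yes S⊆U | yes U⊆T | no U≢T  =
        trans (f-sign U∈𝒫 S⊆U U⊆T U≢T) (sym (+-identityʳ _))
      ... | no U∉𝒫  | yes _   | yes U⊆T | no _    = ⊥-elim (U∉𝒫 (downClosed T∈𝒫 U⊆T))
      ... | yes _   | yes _   | no _    | no _    = refl
      ... | no _    | yes _   | no _    | no _    = refl
      ... | yes _   | no _    | _       | no _    = refl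
      ... | no _    | no _    | _       | no _    = refl

    mobiusFuel-downClosed : ∀ k {S T} → InP n T → S ⊆ T → ∣ T ∣ ∸ ∣ S ∣ ≤ k →
      mobiusFuel n (suc k) S T ≡ -1ℤ ^ (∣ T ∣ ∸ ∣ S ∣)
    mobiusFuel-downClosed k {S} {T} T∈𝒫 S⊆T gap with S ≟ˢ T
    ... | yes refl rewrite n∸n≡0 ∣ S ∣ = refl
    ... | no S≢T with S ⊆? T
    ...   | no S⊈T = ⊥-elim (S⊈T S⊆T)
    ...   | yes _ with k
    ...     | zero  = ⊥-elim (<⇒≱ (m<n⇒0<n∸m (⊂⇒∣∣< S⊆T S≢T)) gap)
    ...     | suc k = trans (cong -_ (sum-strictlyBetween (mobiusFuel n (suc k) S) T∈𝒫 S⊆T S≢T ih))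
                            (neg-involutive _)
      where
      ih : ∀ {U} → InP n U → S ⊆ U → U ⊆ T → U ≢ T →
        mobiusFuel n (suc k) S U ≡ -1ℤ ^ (∣ U ∣ ∸ ∣ S ∣)
      ih U∈𝒫 S⊆U U⊆T U≢T = mobiusFuel-downClosed k U∈𝒫 S⊆U
        (≤-pred (≤-trans (∸-monoˡ-< (⊂⇒∣∣< U⊆T U≢T) (p⊆q⇒∣p∣≤∣q∣ S⊆U)) gap))

open PeakSets using (InP-⊆)
open Möbius using (mobiusFuel-downClosed)

corollary3p2 : (n : ℕ) → 3 ≤ n → (S T : Subset n) → InP n S → InP n T → S ⊆ T →
    μP n S T ≡ -1ℤ ^ (∣ T ∣ ∸ ∣ S ∣)
corollary3p2 n _ S T _ T∈𝒫 S⊆T =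
  mobiusFuel-downClosed InP-⊆ n T∈𝒫 S⊆T (≤-trans (m∸n≤m ∣ T ∣ ∣ S ∣) (∣p∣≤n T))
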